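{- Let $n$ and $m$ be integers with $n \geq m \geq 2$, and let $s = nm - m + \left\lceil \frac{m-4}{3} \right\rceil$. Then $F(P_n \boxtimes P_m) \geq s$, and there exists a set $S$ of $s$ vertices of $P_n \boxtimes P_m$ that is a maximal failed zero forcing set.
   Context: All graphs are simple, finite and undirected; $P_k$ is the path on $k$ vertices. The strong product $G \boxtimes H$ has vertex set $V(G)\times V(H)$, with $(u,v)$ adjacent to $(u',v')$ iff ($uu'\in E(G)$ and $vv'\in E(H)$), or ($u=u'$ and $vv'\in E(H)$), or ($v=v'$ and $uu'\in E(G)$). Zero forcing: each vertex is blue or white; starting from an initial set $S$ of blue vertices, repeatedly apply the color-change rule: if a blue vertex $u$ has exactly one white neighbor $v$, color $v$ blue. $S$ is a zero forcing set if eventually all vertices are blue, and a failed zero forcing set otherwise. $F(G)$ denotes the maximum cardinality of a failed zero forcing set of $G$. A failed zero forcing set $S$ is maximal if every set of vertices properly containing $S$ is a zero forcing set. -}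

module Defs where

open import Data.Nat using (ℕ; zero; suc; _+_; _*_; _∸_; _/_; _≤_)
open import Data.Fin using (Fin; toℕ; remQuot)
open import Data.Fin.Subset using (Subset; _∈_; _⊂_; ∣_∣)
open import Data.Product using (_×_; proj₁; proj₂; ∃)
open import Data.Sum using (_⊎_)
open import Relation.Binary.PropositionalEquality using (_≡_)
open import Relation.Nullary using (¬_)

record Graph : Set₁ where
  field
    N   : ℕ
    Adj : Fin N → Fin N → Set
open Graph public

Path : ℕ → Graph
Path k = record
  { N   = k
  ; Adj = λ i j → (suc (toℕ i) ≡ toℕ j) ⊎ (suc (toℕ j) ≡ toℕ i)
  }

-- Strong product G ⊠ H; vertex (u , v) is encoded in Fin (N G * N H)
-- via Data.Fin.remQuot / combine.
_⊠_ : Graph → Graph → Graph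
G ⊠ H = record
  { N   = N G * N H
  ; Adj = λ x y →
      let u  = proj₁ (remQuot {N G} (N H) x) ; v  = proj₂ (remQuot {N G} (N H) x)
          u' = proj₁ (remQuot {N G} (N H) y) ; v' = proj₂ (remQuot {N G} (N H) y)
      in (Adj G u u' × Adj H v v')
         ⊎ (u ≡ u' × Adj H v v')
         ⊎ (v ≡ v' × Adj G u u')
  }

data Blue (G : Graph) (S : Subset (N G)) : Fin (N G) → Set where
  initial : ∀ {v} → v ∈ S → Blue G S v
  force   : ∀ {u v} → Blue G S u → Adj G u v →
            (∀ w → Adj G u w → (w ≡ v) ⊎ Blue G S w) → Blue G S v

ZeroForcingSet : (G : Graph) → Subset (N G) → Set
ZeroForcingSet G S = ∀ v → Blue G S v

FailedZeroForcingSet : (G : Graph) → Subset (N G) → Set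
FailedZeroForcingSet G S = ¬ ZeroForcingSet G S

MaximalFailedZeroForcingSet : (G : Graph) → Subset (N G) → Set
MaximalFailedZeroForcingSet G S =
  FailedZeroForcingSet G S × (∀ T → S ⊂ T → ZeroForcingSet G T)

IsFailedZeroForcingNumber : (G : Graph) → ℕ → Set
IsFailedZeroForcingNumber G k =
  (∃ λ S → FailedZeroForcingSet G S × ∣ S ∣ ≡ k)
  × (∀ S → FailedZeroForcingSet G S → ∣ S ∣ ≤ k)

-- ⌈(m-4)/3⌉ for m ≥ 2 (the value is 0 for m = 2,3,4), computed in ℕ.
ceilMinus4Div3 : ℕ → ℕ
ceilMinus4Div3 m = (m ∸ 4 + 2) / 3

module Submission where

open import Defs
open import Data.Bool using (Bool; true; false)
open import Data.Bool.Properties using (¬-not)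
open import Data.Nat using (ℕ; zero; suc; _+_; _*_; _∸_; _/_; _≤_; _<_; _≤ᵇ_; _<ᵇ_; z≤n; s≤s; _≤?_; _<?_)
open import Data.Nat.Properties
open import Data.Nat.DivMod using (m/n≡1+[m∸n]/n)
open import Data.Fin using (Fin; zero; suc; toℕ; fromℕ<; combine; remQuot)
open import Data.Fin.Properties using (toℕ-injective; toℕ<n; toℕ-fromℕ<; remQuot-combine; combine-remQuot)
  renaming (_≟_ to _≟ᶠ_)
open import Data.Fin.Subset using (Subset; _∈_; _∉_; _⊂_; ∣_∣; ⊤; ⊥)
open import Data.Fin.Subset.Properties using (∣⊤∣≡n)
open import Data.Vec using ([]; _∷_; _++_; lookup)
open import Data.Vec.Properties using (lookup-++ˡ; lookup-++ʳ; lookup-replicate; []=⇒lookup; lookup⇒[]=)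
open import Data.Product using (_×_; _,_; proj₁; proj₂; ∃; uncurry)
open import Data.Sum using (_⊎_; inj₁; inj₂; [_,_]′)
open import Function using (_∘_)
open import Relation.Nullary using (¬_; yes; no; contradiction)
open import Relation.Binary.PropositionalEquality

-- The white set is row 0 of the grid P_n ⊠ P_m minus the columns 2, 5, 8, …
-- lying at least three columns before its end.  It is a fort: blue columns of
-- row 0 are isolated (no two within distance 2, none within distance 1 of an
-- end), so every vertex with a white neighbour has a second one, and no colour
-- change ever reaches row 0.  Conversely, a vertex of row 1 sees exactly a
-- three-column window of row 0, so two blue vertices in a window force the
-- third.  White runs in row 0 have length at most 4, hence one extra blue
-- vertex yields two adjacent blue columns, and from those the windows sweep
-- the whole row.

IsFort : {V : Set} → (V → V → Set) → (V → Set) → Set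
IsFort _∼_ W = ∀ u v → ¬ W u → W v → u ∼ v → ∃ λ w → u ∼ w × W w × w ≢ v

module _ {G : Graph} {S : Subset (N G)} {W : Fin (N G) → Set}
         (fort : IsFort (Adj G) W) (S-disjoint : ∀ {v} → v ∈ S → ¬ W v) where

  blue⇒∉fort : ∀ {v} → Blue G S v → ¬ W v
  blue⇒∉fort (initial v∈S) = S-disjoint v∈S
  blue⇒∉fort (force {u} {v} blue-u uv others) Wv with fort u v (blue⇒∉fort blue-u) Wv uv
  ... | w , uw , Ww , w≢v with others w uw
  ...   | inj₁ w≡v    = w≢v w≡v
  ...   | inj₂ blue-w = blue⇒∉fort blue-w Ww

  fort⇒failed : ∀ {v} → W v → FailedZeroForcingSet G S
  fort⇒failed Wv all-blue = blue⇒∉fort (all-blue _) Wv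

Near : (G : Graph) → Fin (N G) → Fin (N G) → Set
Near G u v = u ≡ v ⊎ Adj G u v

module StrongProduct (G H : Graph) where

  Pair : Set
  Pair = Fin (N G) × Fin (N H)

  _∼_ : Pair → Pair → Set
  (u , v) ∼ (u' , v') = (Adj G u u' × Adj H v v') ⊎ (u ≡ u' × Adj H v v') ⊎ (v ≡ v' × Adj G u u')

  vertex : Pair → Fin (N (G ⊠ H))
  vertex = uncurry combine

  pair : Fin (N (G ⊠ H)) → Pair
  pair = remQuot {N G} (N H)

  pair-vertex : ∀ p → pair (vertex p) ≡ p
  pair-vertex = uncurry remQuot-combine

  vertex-pair : ∀ x → vertex (pair x) ≡ x
  vertex-pair = combine-remQuot {N G} (N H)

  ∼⇒adj : ∀ {p q} → p ∼ q → Adj (G ⊠ H) (vertex p) (vertex q)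
  ∼⇒adj {p} {q} = subst₂ _∼_ (sym (pair-vertex p)) (sym (pair-vertex q))

  ∼-split : ∀ {a a' b b'} → (a , b) ∼ (a' , b') →
            (Adj G a a' × Near H b b') ⊎ (a ≡ a' × Adj H b b')
  ∼-split (inj₁ (aa' , bb'))        = inj₁ (aa' , inj₂ bb')
  ∼-split (inj₂ (inj₁ a≡a'bb'))     = inj₂ a≡a'bb'
  ∼-split (inj₂ (inj₂ (b≡b' , aa'))) = inj₁ (aa' , inj₁ b≡b')

  adj-near⇒∼ : ∀ {a a' b b'} → Adj G a a' → Near H b b' → (a , b) ∼ (a' , b')
  adj-near⇒∼ aa' (inj₁ b≡b') = inj₂ (inj₂ (b≡b' , aa'))
  adj-near⇒∼ aa' (inj₂ bb')  = inj₁ (aa' , bb')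

  fort : ∀ {W} → IsFort _∼_ W → IsFort (Adj (G ⊠ H)) (W ∘ pair)
  fort {W} isFort u v ¬Wu Wv uv with isFort (pair u) (pair v) ¬Wu Wv uv
  ... | r , ur , Wr , r≢v =
    vertex r , subst (pair u ∼_) (sym (pair-vertex r)) ur , subst W (sym (pair-vertex r)) Wr ,
    λ r≡v → r≢v (trans (sym (pair-vertex r)) (cong pair r≡v))

  force-pair : ∀ {T p q} → Blue (G ⊠ H) T (vertex p) → p ∼ q →
               (∀ {r} → p ∼ r → r ≡ q ⊎ Blue (G ⊠ H) T (vertex r)) →
               Blue (G ⊠ H) T (vertex q)
  force-pair {T} {p} blue-p pq others = force blue-p (∼⇒adj pq) λ w pw →
    [ (λ r≡q → inj₁ (trans (sym (vertex-pair w)) (cong vertex r≡q)))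
    , (λ blue-r → inj₂ (subst (Blue (G ⊠ H) T) (vertex-pair w) blue-r)) ]′
    (others (subst (_∼ pair w) (pair-vertex p) pw))

  all-vertices : ∀ {P : Fin (N (G ⊠ H)) → Set} → (∀ p → P (vertex p)) → ∀ x → P x
  all-vertices {P} P-vertex x = subst P (vertex-pair x) (P-vertex (pair x))

-- Row 0 of the grid in shifted coordinates: position e ∈ [1, m] is column
-- e − 1, while positions 0 and e > m stand for blue columns beyond the ends.
-- Inside, exactly the positions 3, 6, … that are ≤ m − 2 are blue; the
-- recursion maps these to position 0, which is why that clause tests 2 ≤ m.
blueAt : ℕ → ℕ → Bool
blueAt m zero                                 = 2 ≤ᵇ m
blueAt m (suc zero)                           = m <ᵇ 1
blueAt m (suc (suc zero))                     = m <ᵇ 2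
blueAt (suc (suc (suc m))) (suc (suc (suc e))) = blueAt m e
blueAt m (suc (suc (suc e)))                  = m <ᵇ 3 + e

blueAt-0 : ∀ {m} → 2 ≤ m → blueAt m 0 ≡ true
blueAt-0 (s≤s (s≤s _)) = refl

blueAt-beyond : ∀ m {e} → m < e → blueAt m e ≡ true
blueAt-beyond (suc (suc (suc m))) {suc (suc (suc e))} (s≤s (s≤s (s≤s m<e))) = blueAt-beyond m m<e
blueAt-beyond zero {1}                 _ = refl
blueAt-beyond zero {2}                 _ = refl
blueAt-beyond 1    {2}                 _ = refl
blueAt-beyond zero {suc (suc (suc e))} _ = refl
blueAt-beyond 1    {suc (suc (suc e))} _ = refl
blueAt-beyond 2    {suc (suc (suc e))} _ = refl
blueAt-beyond (suc m)       {1} (s≤s ())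
blueAt-beyond (suc (suc m)) {2} (s≤s (s≤s ()))

white⇒≤ : ∀ m {e} → blueAt m e ≡ false → e ≤ m
white⇒≤ m {e} w with e ≤? m
... | yes e≤m = e≤m
... | no e≰m with () ← trans (sym w) (blueAt-beyond m (≰⇒> e≰m))

blue-suc⇒beyond : ∀ m e → blueAt m e ≡ true → blueAt m (suc e) ≡ true → m < e
blue-suc⇒beyond (suc (suc (suc m))) (suc (suc (suc e))) b b' = s≤s (s≤s (s≤s (blue-suc⇒beyond m e b b')))
blue-suc⇒beyond zero (suc e)             _ _ = s≤s z≤n
blue-suc⇒beyond 1    (suc (suc e))       _ _ = s≤s (s≤s z≤n)
blue-suc⇒beyond 2    (suc (suc (suc e))) _ _ = s≤s (s≤s (s≤s z≤n))

blue-2+⇒beyond : ∀ m e → blueAt m e ≡ true → blueAt m (2 + e) ≡ true → m < e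
blue-2+⇒beyond (suc (suc (suc m))) (suc (suc (suc e))) b b' = s≤s (s≤s (s≤s (blue-2+⇒beyond m e b b')))
blue-2+⇒beyond zero (suc e)             _ _ = s≤s z≤n
blue-2+⇒beyond 1    (suc (suc e))       _ _ = s≤s (s≤s z≤n)
blue-2+⇒beyond 2    (suc (suc (suc e))) _ _ = s≤s (s≤s (s≤s z≤n))

blue⇒suc-white : ∀ m {e} → e ≤ m → blueAt m e ≡ true → blueAt m (suc e) ≡ false
blue⇒suc-white m e≤m b = ¬-not (λ b' → ≤⇒≯ e≤m (blue-suc⇒beyond m _ b b'))

blue⇒2+-white : ∀ m {e} → e ≤ m → blueAt m e ≡ true → blueAt m (2 + e) ≡ false
blue⇒2+-white m e≤m b = ¬-not (λ b' → ≤⇒≯ e≤m (blue-2+⇒beyond m _ b b'))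

no-five-whites : ∀ m e → blueAt m (1 + e) ≡ false → blueAt m (2 + e) ≡ false → blueAt m (3 + e) ≡ false →
                 blueAt m e ≡ true ⊎ blueAt m (4 + e) ≡ true
no-five-whites (suc (suc (suc m))) (suc (suc (suc e))) w₁ w₂ w₃ = no-five-whites m e w₁ w₂ w₃
no-five-whites (suc (suc m))     zero _ _ _ = inj₁ refl
no-five-whites 4                 1    _ _ _ = inj₂ refl
no-five-whites 3                 2    _ () _
no-five-whites 4                 2    _ _ ()
no-five-whites (suc (suc (suc (suc (suc m))))) 2 () _ _

Flank : ℕ → ℕ → Set
Flank e t = t ≡ e ⊎ t ≡ 2 + e

Window : ℕ → ℕ → Set
Window e t = Flank e t ⊎ t ≡ suc e

flank-other-white : ∀ m {e t} → e < m → blueAt m (suc e) ≡ true → Flank e t →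
                    ∃ λ d → Flank e d × blueAt m d ≡ false × d ≢ t
flank-other-white m e<m b (inj₁ refl) = _ , inj₂ refl , blue⇒suc-white m e<m b , λ ()
flank-other-white m e<m b (inj₂ refl) =
  _ , inj₁ refl , ¬-not (λ b₀ → <-asym e<m (blue-suc⇒beyond m _ b₀ b)) , λ ()

window-other-white : ∀ m {c t} → c < m → Window c t →
                     ∃ λ d → Window c d × blueAt m d ≡ false × d ≢ t
window-other-white m {c} c<m t∈ with blueAt m c in b₀ | blueAt m (suc c) in b₁ | t∈
... | _     | false | inj₁ (inj₁ refl) = suc c , inj₂ refl , b₁ , λ ()
... | _     | true  | inj₁ (inj₁ refl) = 2 + c , inj₁ (inj₂ refl) , blue⇒suc-white m c<m b₁ , λ ()
... | false | _     | inj₁ (inj₂ refl) = c , inj₁ (inj₁ refl) , b₀ , λ ()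
... | false | _     | inj₂ refl        = c , inj₁ (inj₁ refl) , b₀ , λ ()
... | true  | _     | inj₁ (inj₂ refl) = suc c , inj₂ refl , blue⇒suc-white m (<⇒≤ c<m) b₀ , λ ()
... | true  | _     | inj₂ refl        = 2 + c , inj₁ (inj₂ refl) , blue⇒2+-white m (<⇒≤ c<m) b₀ , λ ()

module Closure (m : ℕ) (Q : ℕ → Set)
  (blue⇒Q : ∀ {e} → blueAt m e ≡ true → Q e)
  (window-rule : ∀ {c t} → c < m → Window c t → (∀ {d} → Window c d → d ≢ t → Q d) → Q t)
  where

  left : ∀ {c} → c < m → Q (suc c) → Q (2 + c) → Q c
  left c<m q₁ q₂ = window-rule c<m (inj₁ (inj₁ refl)) λ where
    (inj₁ (inj₁ refl)) c≢c → contradiction refl c≢c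
    (inj₁ (inj₂ refl)) _   → q₂
    (inj₂ refl)        _   → q₁

  middle : ∀ {c} → c < m → Q c → Q (2 + c) → Q (suc c)
  middle c<m q₀ q₂ = window-rule c<m (inj₂ refl) λ where
    (inj₁ (inj₁ refl)) _   → q₀
    (inj₁ (inj₂ refl)) _   → q₂
    (inj₂ refl)        c≢c → contradiction refl c≢c

  right : ∀ c → Q c → Q (suc c) → Q (2 + c)
  right c q₀ q₁ with c <? m
  ... | no c≮m  = blue⇒Q (blueAt-beyond m (s≤s (m≤n⇒m≤1+n (≮⇒≥ c≮m))))
  ... | yes c<m = window-rule c<m (inj₁ (inj₂ refl)) λ where
    (inj₁ (inj₁ refl)) _   → q₀
    (inj₁ (inj₂ refl)) c≢c → contradiction refl c≢c
    (inj₂ refl)        _   → q₁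

  Adjacent : ℕ → Set
  Adjacent d = Q d × Q (suc d)

  adjacent-above : ∀ {d} i → Adjacent d → Adjacent (i + d)
  adjacent-above zero    q = q
  adjacent-above (suc i) q with adjacent-above i q
  ... | q₀ , q₁ = q₁ , right _ q₀ q₁

  adjacent-below : ∀ i {d} → i + d ≤ m → Adjacent (i + d) → Adjacent d
  adjacent-below zero    _  q         = q
  adjacent-below (suc i) le (q₁ , q₂) = adjacent-below i (<⇒≤ le) (left le q₁ q₂ , q₁)

  adjacent⇒all : ∀ {d} → d ≤ m → Adjacent d → ∀ e → Q e
  adjacent⇒all {d} d≤m q e with e ≤? d
  ... | yes e≤d = proj₁ (adjacent-below (d ∸ e) (subst (_≤ m) (sym d∸e+e≡d) d≤m)
                                        (subst Adjacent (sym d∸e+e≡d) q))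
    where d∸e+e≡d = m∸n+n≡m e≤d
  ... | no e≰d = subst Q (m∸n+n≡m (<⇒≤ (≰⇒> e≰d))) (proj₁ (adjacent-above (e ∸ d) q))

  white⇒all : 2 ≤ m → ∀ {j} → blueAt m j ≡ false → Q j → ∀ e → Q e
  white⇒all 2≤m {zero} w _ with () ← trans (sym w) (blueAt-0 2≤m)
  white⇒all 2≤m {suc zero} _ q₁ = adjacent⇒all z≤n (blue⇒Q (blueAt-0 2≤m) , q₁)
  white⇒all 2≤m {suc (suc h)} w q₂ with blueAt m (3 + h) in b₃ | blueAt m (suc h) in b₁
  ... | true  | _    = adjacent⇒all (white⇒≤ m w) (q₂ , blue⇒Q b₃)
  ... | false | true = adjacent⇒all (<⇒≤ (white⇒≤ m w)) (blue⇒Q b₁ , q₂)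
  ... | false | false with no-five-whites m h b₁ w b₃
  ...   | inj₁ b₀ = adjacent⇒all (<⇒≤ (white⇒≤ m w)) (middle (<⇒≤ (white⇒≤ m w)) (blue⇒Q b₀) q₂ , q₂)
  ...   | inj₂ b₄ = adjacent⇒all (white⇒≤ m w) (q₂ , middle (white⇒≤ m b₃) q₂ (blue⇒Q b₄))

module _ {k : ℕ} {b c : Fin k} where

  adj⇒flank : Adj (Path k) b c → Flank (toℕ b) (suc (toℕ c))
  adj⇒flank (inj₁ e) = inj₂ (cong suc (sym e))
  adj⇒flank (inj₂ e) = inj₁ e

  flank⇒adj : Flank (toℕ b) (suc (toℕ c)) → Adj (Path k) b c
  flank⇒adj (inj₁ e) = inj₂ e
  flank⇒adj (inj₂ e) = inj₁ (suc-injective (sym e))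

  near⇒window : Near (Path k) b c → Window (toℕ b) (suc (toℕ c))
  near⇒window (inj₁ refl) = inj₂ refl
  near⇒window (inj₂ bc)   = inj₁ (adj⇒flank bc)

  window⇒near : Window (toℕ b) (suc (toℕ c)) → Near (Path k) b c
  window⇒near (inj₁ fl) = inj₂ (flank⇒adj fl)
  window⇒near (inj₂ e)  = inj₁ (toℕ-injective (suc-injective (sym e)))

blueColumns : (m : ℕ) → Subset m
blueColumns (suc (suc (suc m))) = false ∷ false ∷ blueAt m 0 ∷ blueColumns m
blueColumns m                   = ⊥

lookup-blueColumns : ∀ m (f : Fin m) → lookup (blueColumns m) f ≡ blueAt m (suc (toℕ f))
lookup-blueColumns (suc (suc (suc m))) zero                   = refl
lookup-blueColumns (suc (suc (suc m))) (suc zero)             = refl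
lookup-blueColumns (suc (suc (suc m))) (suc (suc zero))       = refl
lookup-blueColumns (suc (suc (suc m))) (suc (suc (suc f)))    = lookup-blueColumns m f
lookup-blueColumns 1                   zero                   = refl
lookup-blueColumns 2                   zero                   = refl
lookup-blueColumns 2                   (suc zero)             = refl

ceilMinus4Div3-+3 : ∀ k → ceilMinus4Div3 (5 + k) ≡ suc (ceilMinus4Div3 (2 + k))
ceilMinus4Div3-+3 k = begin
  (suc k + 2) / 3           ≡⟨ m/n≡1+[m∸n]/n (s≤s (m≤n+m 2 k)) ⟩
  suc ((k + 2 ∸ 2) / 3)     ≡⟨ cong (λ x → suc (x / 3)) (m+n∸n≡m k 2) ⟩
  suc (k / 3)               ≡⟨ cong suc (shift k) ⟩
  suc ((k ∸ 2 + 2) / 3)     ∎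
  where
  open ≡-Reasoning
  shift : ∀ k → k / 3 ≡ (k ∸ 2 + 2) / 3
  shift 0               = refl
  shift 1               = refl
  shift (suc (suc k))   = cong (_/ 3) (+-comm 2 k)

∣blueColumns∣ : ∀ m → ∣ blueColumns m ∣ ≡ ceilMinus4Div3 m
∣blueColumns∣ 0                       = refl
∣blueColumns∣ 1                       = refl
∣blueColumns∣ 2                       = refl
∣blueColumns∣ 3                       = refl
∣blueColumns∣ 4                       = refl
∣blueColumns∣ (suc (suc (suc (suc (suc k))))) =
  trans (cong suc (∣blueColumns∣ (suc (suc k)))) (sym (ceilMinus4Div3-+3 k))

∣++∣ : ∀ {a b} (p : Subset a) (q : Subset b) → ∣ p ++ q ∣ ≡ ∣ p ∣ + ∣ q ∣
∣++∣ []          q = refl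
∣++∣ (true ∷ p)  q = cong suc (∣++∣ p q)
∣++∣ (false ∷ p) q = ∣++∣ p q

module Construction (n′ m′ : ℕ) where

  n m : ℕ
  n = 2 + n′
  m = 2 + m′

  open StrongProduct (Path n) (Path m)

  colour : Pair → Bool
  colour (zero  , b) = blueAt m (suc (toℕ b))
  colour (suc _ , _) = true

  S : Subset (n * m)
  S = blueColumns m ++ ⊤

  lookup-S : ∀ p → lookup S (vertex p) ≡ colour p
  lookup-S (zero  , b) = trans (lookup-++ˡ (blueColumns m) ⊤ b) (lookup-blueColumns m b)
  lookup-S (suc a , b) = trans (lookup-++ʳ (blueColumns m) ⊤ (combine a b)) (lookup-replicate (combine a b) true)

  blue⇒∈S : ∀ p → colour p ≡ true → vertex p ∈ S
  blue⇒∈S p c = lookup⇒[]= _ S (trans (lookup-S p) c)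

  White : Pair → Set
  White p = colour p ≡ false

  lookup-S-pair : ∀ x → lookup S x ≡ colour (pair x)
  lookup-S-pair x = trans (cong (lookup S) (sym (vertex-pair x))) (lookup-S (pair x))

  ∈S⇒¬White : ∀ {x} → x ∈ S → ¬ White (pair x)
  ∈S⇒¬White {x} x∈S w with () ← trans (sym w) (trans (sym (lookup-S-pair x)) ([]=⇒lookup x∈S))

  ∉S⇒White : ∀ {x} → x ∉ S → White (pair x)
  ∉S⇒White {x} x∉S = ¬-not λ c → x∉S (lookup⇒[]= x S (trans (lookup-S-pair x) c))

  column : ∀ {d} → blueAt m d ≡ false → ∃ λ (f : Fin m) → suc (toℕ f) ≡ d
  column {suc d} w = fromℕ< (white⇒≤ m w) , cong suc (toℕ-fromℕ< _)

  white-fort : IsFort _∼_ White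
  white-fort (a , b) (zero , c) ¬W Wc ab∼0c with ∼-split ab∼0c
  ... | inj₁ (a∼0 , b≈c)
    with d , d∈ , Wd , d≢t ← window-other-white m (toℕ<n b) (near⇒window b≈c)
    with f , refl ← column {d} Wd
    = (zero , f) , adj-near⇒∼ a∼0 (window⇒near d∈) , Wd , d≢t ∘ cong (suc ∘ toℕ ∘ proj₂)
  ... | inj₂ (refl , b∼c)
    with d , d∈ , Wd , d≢t ← flank-other-white m (toℕ<n b) (¬-not ¬W) (adj⇒flank b∼c)
    with f , refl ← column {d} Wd
    = (zero , f) , inj₂ (inj₁ (refl , flank⇒adj d∈)) , Wd , d≢t ∘ cong (suc ∘ toℕ ∘ proj₂)

  failed : FailedZeroForcingSet (Path n ⊠ Path m) S
  failed = fort⇒failed (fort white-fort) ∈S⇒¬White {vertex (zero , zero)}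
                       (subst White (sym (pair-vertex (zero , zero))) refl)

  module _ {T : Subset (n * m)} (S⊂T : S ⊂ T) where

    Blueᵀ : Fin (n * m) → Set
    Blueᵀ = Blue (Path n ⊠ Path m) T

    blue-S : ∀ p → colour p ≡ true → Blueᵀ (vertex p)
    blue-S p c = initial (proj₁ S⊂T (blue⇒∈S p c))

    -- Vacuous at the positions 0 and > m, which carry no column.
    Q : ℕ → Set
    Q e = ∀ {f} → suc (toℕ f) ≡ e → Blueᵀ (vertex (zero , f))

    window-rule : ∀ {c t} → c < m → Window c t → (∀ {d} → Window c d → d ≢ t → Q d) → Q t
    window-rule c<m t∈ others {f} refl with fromℕ< c<m | toℕ-fromℕ< c<m
    ... | col | refl = force-pair (blue-S (suc zero , col) refl) (adj-near⇒∼ (inj₂ refl) (window⇒near t∈)) forced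
      where
      forced : ∀ {r} → (suc zero , col) ∼ r → r ≡ (zero , f) ⊎ Blueᵀ (vertex r)
      forced {r@(suc _ , _)} _ = inj₂ (blue-S r refl)
      forced {zero , d} r∼ with ∼-split r∼ | d ≟ᶠ f
      ... | inj₂ (() , _)    | _
      ... | inj₁ _           | yes refl = inj₁ refl
      ... | inj₁ (_ , col≈d) | no d≢f   =
        inj₂ (others (near⇒window col≈d) (d≢f ∘ toℕ-injective ∘ suc-injective) refl)

    seed : ∃ λ j → blueAt m j ≡ false × Q j
    seed with x , x∈T , x∉S ← proj₂ S⊂T =
      white-seed (pair x) (∉S⇒White x∉S) (subst Blueᵀ (sym (vertex-pair x)) (initial x∈T))
      where
      white-seed : ∀ p → White p → Blueᵀ (vertex p) → ∃ λ j → blueAt m j ≡ false × Q j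
      white-seed (zero , b) w blue-b = suc (toℕ b) , w , λ e →
        subst (λ f → Blueᵀ (vertex (zero , f))) (toℕ-injective (suc-injective (sym e))) blue-b

    all-blue : ZeroForcingSet (Path n ⊠ Path m) T
    all-blue = all-vertices blue
      where
      open Closure m Q (λ b {f} e → blue-S (zero , f) (trans (cong (blueAt m) e) b)) window-rule
      blue : ∀ p → Blueᵀ (vertex p)
      blue p@(suc _ , _) = blue-S p refl
      blue (zero  , b) with j , w , qj ← seed = white⇒all (s≤s (s≤s z≤n)) w qj (suc (toℕ b)) refl

  maximal : MaximalFailedZeroForcingSet (Path n ⊠ Path m) S
  maximal = failed , λ T S⊂T → all-blue S⊂T

  ∣S∣ : ∣ S ∣ ≡ n * m ∸ m + ceilMinus4Div3 m
  ∣S∣ = begin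
    ∣ blueColumns m ++ ⊤ ∣                   ≡⟨ ∣++∣ (blueColumns m) ⊤ ⟩
    ∣ blueColumns m ∣ + ∣ ⊤ {suc n′ * m} ∣    ≡⟨ cong₂ _+_ (∣blueColumns∣ m) (∣⊤∣≡n _) ⟩
    ceilMinus4Div3 m + suc n′ * m            ≡⟨ +-comm (ceilMinus4Div3 m) _ ⟩
    suc n′ * m + ceilMinus4Div3 m            ≡⟨ cong (_+ ceilMinus4Div3 m) (m+n∸m≡n m _) ⟨
    n * m ∸ m + ceilMinus4Div3 m             ∎
    where open ≡-Reasoning

theorem3p10 : (n m : ℕ) → 2 ≤ m → m ≤ n →
    let s = n * m ∸ m + ceilMinus4Div3 m in
    (∀ k → IsFailedZeroForcingNumber (Path n ⊠ Path m) k → s ≤ k)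
    × (∃ λ (S : Subset (N (Path n ⊠ Path m))) →
         ∣ S ∣ ≡ s × MaximalFailedZeroForcingSet (Path n ⊠ Path m) S)
theorem3p10 (suc (suc n′)) (suc (suc m′)) (s≤s (s≤s z≤n)) (s≤s (s≤s _)) =
  (λ k (_ , maximum) → subst (_≤ k) ∣S∣ (maximum S failed)) , S , ∣S∣ , maximal
  where open Construction n′ m′
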